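{- Let $G$ be a $P_5$-free graph. Let $(X,Z)$ be a cradle in $G$ such that some vertex in $Z$ is not complete to $X$, and let $(\mathcal{I},\mathcal{J})$ be a rocker for $(X,Z)$. Then for every $(X,Z)$-restricted maximum stable set $S$ of $G$, we have $S\cap V(Q)\neq \emptyset$ for some $Q\in \mathcal{I}\cup \mathcal{J}$.
   Context: All graphs are finite and simple; $G$ is $P_5$-free if no induced subgraph is isomorphic to the five-vertex path. A maximum stable set is a stable set of maximum cardinality. For $X\subseteq V(G)$, $N(X)$ is the set of vertices of $V(G)\setminus X$ with a neighbour in $X$, $N[X]=N(X)\cup X$, and $N_Z(X)=N(X)\cap Z$. A cradle in $G$ is a pair $(X,Z)$ of disjoint subsets of $V(G)$ such that either $|X|\leq 1$, or both: every vertex in $N_Z(X)$ has a neighbour in $V(G)\setminus N[X]$; and for every two vertices $z,z'\in N_Z(X)$ there is an induced path in $G$ from $z$ to $z'$ whose interior vertices lie in $V(G)\setminus N[X]$. A vertex is complete (anticomplete) to a set if it is adjacent to all (none) of its vertices. A rocker for $(X,Z)$ is a pair $(\mathcal{I},\mathcal{J})$ of collections of connected components of $G[X]$ such that: for every $z\in Z$ anticomplete to some component of $G[X]$ there is $D\in\mathcal{I}$ with $z$ anticomplete to $D$, and $\mathcal{I}$ is inclusion-minimal with this property; and $\mathcal{J}$ is the collection of all components $D$ of $G[X]$ for which some $z\in Z$ has a neighbour in every component of $G[X]$ and a non-neighbour in $D$. A set $S\subseteq V(G)$ is $(X,Z)$-restricted if $S\subseteq X\cup Z$ and $S\cap X\neq\emptyset$.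 -}

module Defs where

open import Level using (0ℓ)
open import Data.Nat using (ℕ; suc; _≤_; _<_)
open import Data.Fin using (Fin; toℕ)
open import Data.Fin.Subset public using (Subset; _∈_; _∉_; _⊆_; ∣_∣)
open import Data.List using (List; []; _∷_; _++_; length; lookup)
open import Data.List.Relation.Unary.All using (All)
open import Data.Product using (Σ; ∃; ∃-syntax; _×_; _,_)
open import Data.Sum using (_⊎_)
open import Data.Empty using (⊥)
open import Relation.Nullary using (¬_; Dec)
open import Relation.Binary.PropositionalEquality using (_≡_; _≢_)
open import Relation.Binary.Construct.Closure.ReflexiveTransitive using (Star)

record Graph : Set₁ where
  field
    n     : ℕ
    _~_   : Fin n → Fin n → Set
    ~-dec : ∀ u v → Dec (u ~ v)
    ~-sym : ∀ {u v} → u ~ v → v ~ u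
    ~-irr : ∀ u → ¬ (u ~ u)

module _ (G : Graph) where
  open Graph G

  V : Set
  V = Fin n

  IsInducedPath : List V → Set
  IsInducedPath p =
    (∀ (i j : Fin (length p)) → i ≢ j → lookup p i ≢ lookup p j)
    × (∀ (i j : Fin (length p)) → toℕ j ≡ suc (toℕ i) → lookup p i ~ lookup p j)
    × (∀ (i j : Fin (length p)) → suc (toℕ i) < toℕ j → ¬ (lookup p i ~ lookup p j))

  P5Free : Set
  P5Free = ¬ (Σ (List V) λ p → length p ≡ 5 × IsInducedPath p)

  Stable : Subset n → Set
  Stable S = ∀ u v → u ∈ S → v ∈ S → ¬ (u ~ v)

  MaximumStable : Subset n → Set
  MaximumStable S = Stable S × (∀ T → Stable T → ∣ T ∣ ≤ ∣ S ∣)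

  Disjoint : Subset n → Subset n → Set
  Disjoint A B = ∀ v → v ∈ A → v ∈ B → ⊥

  InN : Subset n → V → Set
  InN X v = v ∉ X × ∃[ x ] (x ∈ X × v ~ x)

  OutsideN[ : Subset n → V → Set
  OutsideN[ X v = v ∉ X × (∀ x → x ∈ X → ¬ (v ~ x))

  Cradle : Subset n → Subset n → Set
  Cradle X Z =
    Disjoint X Z ×
    (∣ X ∣ ≤ 1 ⊎
      ((∀ z → z ∈ Z → InN X z → ∃[ w ] (z ~ w × OutsideN[ X w))
      × (∀ z z' → z ∈ Z → InN X z → z' ∈ Z → InN X z' → z ≢ z' →
           Σ (List V) λ interior →
             IsInducedPath (z ∷ interior ++ z' ∷ [])
             × All (OutsideN[ X) interior)))

  EdgeIn : Subset n → V → V → Set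
  EdgeIn D u v = u ∈ D × v ∈ D × u ~ v

  Component : Subset n → Subset n → Set
  Component X D =
    D ⊆ X
    × (∃[ v ] v ∈ D)
    × (∀ u v → u ∈ D → v ∈ D → Star (EdgeIn D) u v)
    × (∀ u v → u ∈ D → v ∈ X → u ~ v → v ∈ D)

  CompleteTo : V → Subset n → Set
  CompleteTo v A = ∀ x → x ∈ A → v ~ x

  AnticompleteTo : V → Subset n → Set
  AnticompleteTo v A = ∀ x → x ∈ A → ¬ (v ~ x)

  Collection : Set₁
  Collection = Subset n → Set

  Covers : Subset n → Subset n → Collection → Set
  Covers X Z 𝓘 =
    ∀ z → z ∈ Z → (∃[ D ] (Component X D × AnticompleteTo z D)) →
      ∃[ D ] (𝓘 D × AnticompleteTo z D)

  Rocker : Subset n → Subset n → Collection → Collection → Set₁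
  Rocker X Z 𝓘 𝓙 =
    (∀ D → 𝓘 D → Component X D)
    × Covers X Z 𝓘
    × (∀ (𝓘' : Collection) → (∀ D → 𝓘' D → 𝓘 D) → Covers X Z 𝓘' →
         ∀ D → 𝓘 D → 𝓘' D)
    × (∀ D → 𝓙 D →
         Component X D
         × ∃[ z ] (z ∈ Z
                   × (∀ D' → Component X D' → ∃[ x ] (x ∈ D' × z ~ x))
                   × ∃[ x ] (x ∈ D × ¬ (z ~ x))))
    × (∀ D → Component X D →
         (∃[ z ] (z ∈ Z
                  × (∀ D' → Component X D' → ∃[ x ] (x ∈ D' × z ~ x))
                  × ∃[ x ] (x ∈ D × ¬ (z ~ x))))
         → 𝓙 D)

  Restricted : Subset n → Subset n → Subset n → Set
  Restricted X Z S = (∀ v → v ∈ S → v ∈ X ⊎ v ∈ Z) × ∃[ x ] (x ∈ S × x ∈ X)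

{-# OPTIONS --safe #-}
-- Some vertex of Z is not complete to X, so some component of G[X] lies in 𝓘 ∪ 𝓙; by
-- maximality either S meets it or one of its vertices has a neighbour s ∈ S, necessarily in Z.
-- Given s ∈ S ∩ Z: if s has a neighbour in every component, the component of a vertex of
-- S ∩ X lies in 𝓙; otherwise s is anticomplete to some Q ∈ 𝓘, and either S meets Q or a
-- vertex b ∈ Q has a neighbour s′ ∈ S ∩ Z.  Then N(s) ∩ X ⊊ N(s′) ∩ X, since a neighbour a
-- of s missed by s′ would start an induced P5 a, s, … along an induced cradle path from s to
-- s′ (closed by s′, b when the path has one interior vertex).  As N(s) ∩ X cannot grow
-- forever, S meets a member of 𝓘 ∪ 𝓙.
module Submission where

open import Defs
open import Data.Bool.Properties using (T-≡)
open import Data.Empty using (⊥)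
open import Data.Fin using (Fin; toℕ; zero; suc)
open import Data.Fin.Properties using (any?; all?; ¬∀⟶∃¬; toℕ-injective)
open import Data.Fin.Subset using (_⊂_; _∪_; ⁅_⁆) renaming (⊥ to ∅)
open import Data.Fin.Subset.Properties
  using (_∈?_; x∈⁅x⁆; x∈⁅y⁆⇒x≡y; p⊆p∪q; q⊆p∪q; x∈p∪q⁻; p⊂q⇒∣p∣<∣q∣; ∣p∣≤n; ∣⁅x⁆∣≡1)
open import Data.List using (List; []; _∷_; _++_; length; lookup)
open import Data.List.Membership.Propositional.Properties using (∈-lookup)
open import Data.List.Relation.Unary.All as All using (All; []; _∷_)
open import Data.List.Relation.Unary.All.Properties using (++⁺)
open import Data.Nat using (ℕ; zero; suc; _+_; _≤_; _<_; s≤s)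
open import Data.Nat.Properties using (<⇒≱; m≤m+n; +-suc; +-monoʳ-≤; suc-injective; module ≤-Reasoning)
open import Data.Product using (Σ; ∃-syntax; _×_; _,_; proj₁; proj₂)
open import Data.Sum using (_⊎_; inj₁; inj₂)
open import Data.Vec using (tabulate)
open import Data.Vec.Properties using (lookup∘tabulate; lookup⇒[]=; []=⇒lookup)
open import Function using (_∘_; id)
open import Function.Bundles using (Equivalence)
open import Relation.Binary.Construct.Closure.ReflexiveTransitive using (Star; ε; _◅_; _◅◅_; gmap; reverse)
open import Relation.Binary.PropositionalEquality using (_≡_; _≢_; refl; sym; trans; cong; subst; subst₂)
open import Relation.Nullary using (¬_; Dec; yes; no; contradiction)
open import Relation.Nullary.Decidable using (⌊_⌋; _×-dec_; _→-dec_; ¬?; toWitness; fromWitness; decidable-stable)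
open import Relation.Unary using (Pred; Decidable)

module _ {a g} {A : Set a} {Goal : Set g} (size : A → ℕ) {bound : ℕ}
         (size≤bound : ∀ x → size x ≤ bound) where

  ascend : (∀ x → Goal ⊎ Σ A (λ y → size x < size y)) → A → Goal
  ascend step x = go (suc bound) x (s≤s (m≤m+n bound (size x)))
    where
    go : ∀ k x → bound < k + size x → Goal
    go zero    x bound<size = contradiction (size≤bound x) (<⇒≱ bound<size)
    go (suc k) x bound<     with step x
    ... | inj₁ goal      = goal
    ... | inj₂ (y , x<y) = go k y (begin-strict
      bound            <⟨ bound< ⟩
      suc k + size x   ≡⟨ sym (+-suc k (size x)) ⟩
      k + suc (size x) ≤⟨ +-monoʳ-≤ k x<y ⟩
      k + size y       ∎)
      where open ≤-Reasoning

module _ {n ℓ} {P : Pred (Fin n) ℓ} (P? : Decidable P) where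

  select : Subset n
  select = tabulate (⌊_⌋ ∘ P?)

  ∈-select⁺ : ∀ {i} → P i → i ∈ select
  ∈-select⁺ {i} p =
    lookup⇒[]= i select (trans (lookup∘tabulate (⌊_⌋ ∘ P?) i) (Equivalence.to T-≡ (fromWitness p)))

  ∈-select⁻ : ∀ {i} → i ∈ select → P i
  ∈-select⁻ {i} i∈ = toWitness {a? = P? i}
    (Equivalence.from T-≡ (trans (sym (lookup∘tabulate (⌊_⌋ ∘ P?) i)) ([]=⇒lookup i∈)))

x∈p∧y∈p∧x≢y⇒1<∣p∣ : ∀ {n} {p : Subset n} {x y} → x ∈ p → y ∈ p → x ≢ y → 1 < ∣ p ∣
x∈p∧y∈p∧x≢y⇒1<∣p∣ {p = p} {x} {y} x∈p y∈p x≢y =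
  subst (_< ∣ p ∣) (∣⁅x⁆∣≡1 x) (p⊂q⇒∣p∣<∣q∣ (⁅x⁆⊆p , y , y∈p , x≢y ∘ sym ∘ x∈⁅y⁆⇒x≡y x))
  where
  ⁅x⁆⊆p : ⁅ x ⁆ ⊆ p
  ⁅x⁆⊆p z∈ = subst (_∈ p) (sym (x∈⁅y⁆⇒x≡y x z∈)) x∈p

module _ {a} {A : Set a} where

  inject++ : ∀ (p q : List A) → Fin (length p) → Fin (length (p ++ q))
  inject++ (x ∷ p) q zero    = zero
  inject++ (x ∷ p) q (suc i) = suc (inject++ p q i)

  toℕ-inject++ : ∀ p q i → toℕ (inject++ p q i) ≡ toℕ i
  toℕ-inject++ (x ∷ p) q zero    = refl
  toℕ-inject++ (x ∷ p) q (suc i) = cong suc (toℕ-inject++ p q i)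

  lookup-inject++ : ∀ p q i → lookup (p ++ q) (inject++ p q i) ≡ lookup p i
  lookup-inject++ (x ∷ p) q zero    = refl
  lookup-inject++ (x ∷ p) q (suc i) = lookup-inject++ p q i

module _ (G : Graph) where
  open Graph G

  adjacent⇒≢ : ∀ {u v} → u ~ v → u ≢ v
  adjacent⇒≢ {u} u~v refl = ~-irr u u~v

  ∈∧∉⇒≢ : ∀ {A : Subset n} {u v} → u ∈ A → v ∉ A → u ≢ v
  ∈∧∉⇒≢ u∈A v∉A refl = v∉A u∈A

  ¬complete⇒non-neighbour : ∀ {v A} → ¬ CompleteTo G v A → ∃[ x ] (x ∈ A × ¬ v ~ x)
  ¬complete⇒non-neighbour {v} {A} ¬complete
    with ¬∀⟶∃¬ n _ (λ x → x ∈? A →-dec ~-dec v x) ¬complete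
  ... | x , ¬[x∈A→v~x] =
    x , decidable-stable (x ∈? A) (λ x∉A → ¬[x∈A→v~x] (λ x∈A → contradiction x∈A x∉A))
      , λ v~x → ¬[x∈A→v~x] (λ _ → v~x)

  induced-[_] : ∀ x → IsInducedPath G (x ∷ [])
  induced-[ x ] = (λ { zero zero 0≢0 → contradiction refl 0≢0 }) , (λ { zero zero () }) , (λ { zero zero () })

  induced-∷ : ∀ {x y q} → x ~ y → All (x ≢_) (y ∷ q) → All (λ z → ¬ x ~ z) q →
              IsInducedPath G (y ∷ q) → IsInducedPath G (x ∷ y ∷ q)
  induced-∷ {x} {y} {q} x~y x≢ x≁ (distinct , adjacent , nonadjacent) =
    distinct′ , adjacent′ , nonadjacent′
    where
    distinct′ : ∀ i j → i ≢ j → lookup (x ∷ y ∷ q) i ≢ lookup (x ∷ y ∷ q) j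
    distinct′ zero    zero    i≢j = contradiction refl i≢j
    distinct′ zero    (suc j) _   = All.lookup x≢ (∈-lookup j)
    distinct′ (suc i) zero    _   = All.lookup x≢ (∈-lookup i) ∘ sym
    distinct′ (suc i) (suc j) i≢j = distinct i j (i≢j ∘ cong suc)

    adjacent′ : ∀ i j → toℕ j ≡ suc (toℕ i) → lookup (x ∷ y ∷ q) i ~ lookup (x ∷ y ∷ q) j
    adjacent′ zero    (suc zero)    _     = x~y
    adjacent′ (suc i) (suc j)       j≡1+i = adjacent i j (suc-injective j≡1+i)
    adjacent′ zero    zero          ()
    adjacent′ zero    (suc (suc j)) ()
    adjacent′ (suc i) zero          ()

    nonadjacent′ : ∀ i j → suc (toℕ i) < toℕ j → ¬ lookup (x ∷ y ∷ q) i ~ lookup (x ∷ y ∷ q) j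
    nonadjacent′ zero    (suc (suc j)) _            = All.lookup x≁ (∈-lookup j)
    nonadjacent′ (suc i) (suc j)       (s≤s 2+i≤j) = nonadjacent i j 2+i≤j
    nonadjacent′ zero    zero          ()
    nonadjacent′ zero    (suc zero)    (s≤s ())
    nonadjacent′ (suc i) zero          ()

  induced-++⁻ˡ : ∀ p {q} → IsInducedPath G (p ++ q) → IsInducedPath G p
  induced-++⁻ˡ p {q} (distinct , adjacent , nonadjacent) =
    (λ i j i≢j → subst₂ _≢_ (lookup-ι i) (lookup-ι j) (distinct (ι i) (ι j) (i≢j ∘ ι-injective)))
    , (λ i j j≡1+i → subst₂ _~_ (lookup-ι i) (lookup-ι j)
         (adjacent (ι i) (ι j) (subst₂ (λ a b → b ≡ suc a) (sym (toℕ-ι i)) (sym (toℕ-ι j)) j≡1+i)))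
    , (λ i j 1+i<j → subst₂ (λ a b → ¬ a ~ b) (lookup-ι i) (lookup-ι j)
         (nonadjacent (ι i) (ι j) (subst₂ (λ a b → suc a < b) (sym (toℕ-ι i)) (sym (toℕ-ι j)) 1+i<j)))
    where
    ι = inject++ p q
    toℕ-ι = toℕ-inject++ p q
    lookup-ι = lookup-inject++ p q
    ι-injective : ∀ {i j} → ι i ≡ ι j → i ≡ j
    ι-injective {i} {j} ιi≡ιj = toℕ-injective (trans (sym (toℕ-ι i)) (trans (cong toℕ ιi≡ιj) (toℕ-ι j)))

  P5Free⇒¬induced-path≥5 : P5Free G → ∀ {a b c d e p} → ¬ IsInducedPath G (a ∷ b ∷ c ∷ d ∷ e ∷ p)
  P5Free⇒¬induced-path≥5 p5 {a} {b} {c} {d} {e} path =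
    p5 (a ∷ b ∷ c ∷ d ∷ e ∷ [] , refl , induced-++⁻ˡ (a ∷ b ∷ c ∷ d ∷ e ∷ []) path)

  cradle-no-private-neighbours : P5Free G → ∀ {X Z} → Cradle G X Z →
    ∀ {a b s s′} → a ∈ X → b ∈ X → s ∈ Z → s′ ∈ Z → ¬ s ~ s′ →
    s ~ a → ¬ s′ ~ a → s′ ~ b → ¬ s ~ b → ¬ a ~ b → ⊥
  cradle-no-private-neighbours _ (_ , inj₁ ∣X∣≤1) a∈X b∈X _ _ _ s~a _ _ s≁b _ =
    <⇒≱ (x∈p∧y∈p∧x≢y⇒1<∣p∣ a∈X b∈X λ { refl → s≁b s~a }) ∣X∣≤1
  cradle-no-private-neighbours p5 {X} {Z} (disjoint , inj₂ (_ , paths)) {a} {b} {s} {s′}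
    a∈X b∈X s∈Z s′∈Z s≁s′ s~a s′≁a s′~b s≁b a≁b =
    through (paths s s′ s∈Z (∉X s∈Z , a , a∈X , s~a) s′∈Z (∉X s′∈Z , b , b∈X , s′~b) s≢s′)
    where
    ∉X : ∀ {z} → z ∈ Z → z ∉ X
    ∉X z∈Z z∈X = disjoint _ z∈X z∈Z

    s≢s′ : s ≢ s′
    s≢s′ refl = s′≁a s~a

    a≢outside : ∀ {p} → OutsideN[ G X p → a ≢ p
    a≢outside (p∉X , _) = ∈∧∉⇒≢ a∈X p∉X

    a≁outside : ∀ {p} → OutsideN[ G X p → ¬ a ~ p
    a≁outside (_ , p≁X) = p≁X a a∈X ∘ ~-sym

    prepend-a : ∀ {interior} → All (OutsideN[ G X) interior →
                IsInducedPath G (s ∷ interior ++ s′ ∷ []) → IsInducedPath G (a ∷ s ∷ interior ++ s′ ∷ [])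
    prepend-a outside = induced-∷ (~-sym s~a)
      (adjacent⇒≢ (~-sym s~a) ∷ ++⁺ (All.map a≢outside outside) (∈∧∉⇒≢ a∈X (∉X s′∈Z) ∷ []))
      (++⁺ (All.map a≁outside outside) ((s′≁a ∘ ~-sym) ∷ []))

    through : (Σ (List (V G)) λ interior →
                 IsInducedPath G (s ∷ interior ++ s′ ∷ []) × All (OutsideN[ G X) interior) → ⊥
    through ([] , (_ , adjacent , _) , []) = s≁s′ (adjacent zero (suc zero) refl)
    through (p ∷ [] , (_ , adjacent , _) , p-outside ∷ []) =
      p5 (a ∷ s ∷ p ∷ s′ ∷ b ∷ [] , refl ,
        induced-∷ (~-sym s~a) (adjacent⇒≢ (~-sym s~a) ∷ a≢outside p-outside ∷ ∈∧∉⇒≢ a∈X (∉X s′∈Z) ∷ a≢b ∷ [])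
                              (a≁outside p-outside ∷ s′≁a ∘ ~-sym ∷ a≁b ∷ [])
        (induced-∷ s~p (adjacent⇒≢ s~p ∷ s≢s′ ∷ ∈∧∉⇒≢ b∈X (∉X s∈Z) ∘ sym ∷ []) (s≁s′ ∷ s≁b ∷ [])
        (induced-∷ p~s′ (adjacent⇒≢ p~s′ ∷ p≢b ∷ []) (proj₂ p-outside b b∈X ∷ [])
        (induced-∷ s′~b (adjacent⇒≢ s′~b ∷ []) [] induced-[ b ]))))
      where
      s~p = adjacent zero (suc zero) refl
      p~s′ = adjacent (suc zero) (suc (suc zero)) refl
      a≢b : a ≢ b
      a≢b refl = s≁b s~a
      p≢b : p ≢ b
      p≢b = ∈∧∉⇒≢ b∈X (proj₁ p-outside) ∘ sym
    through (_ ∷ _ ∷ [] , path , outside) = P5Free⇒¬induced-path≥5 p5 (prepend-a outside path)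
    through (_ ∷ _ ∷ _ ∷ _ , path , outside) = P5Free⇒¬induced-path≥5 p5 (prepend-a outside path)

  cradle-shared-neighbour : P5Free G → ∀ {X Z} → Cradle G X Z →
    ∀ {a b s s′} → a ∈ X → b ∈ X → s ∈ Z → s′ ∈ Z → ¬ s ~ s′ →
    s ~ a → s′ ~ b → ¬ s ~ b → ¬ a ~ b → s′ ~ a
  cradle-shared-neighbour p5 cradle {a} {s′ = s′} a∈X b∈X s∈Z s′∈Z s≁s′ s~a s′~b s≁b a≁b =
    decidable-stable (~-dec s′ a) λ s′≁a →
      cradle-no-private-neighbours p5 cradle a∈X b∈X s∈Z s′∈Z s≁s′ s~a s′≁a s′~b s≁b a≁b

  maximum-stable⇒dominating : ∀ {S} → MaximumStable G S → ∀ {q} → q ∉ S → ∃[ s ] (s ∈ S × q ~ s)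
  maximum-stable⇒dominating {S} (stable , maximum) {q} q∉S =
    decidable-stable (any? λ s → s ∈? S ×-dec ~-dec q s) λ undominated →
      <⇒≱ (p⊂q⇒∣p∣<∣q∣ (p⊆p∪q ⁅ q ⁆ , q , q⊆p∪q S ⁅ q ⁆ (x∈⁅x⁆ q) , q∉S))
          (maximum (S ∪ ⁅ q ⁆) (stable-∪ undominated))
    where
    stable-∪ : ¬ (∃[ s ] (s ∈ S × q ~ s)) → Stable G (S ∪ ⁅ q ⁆)
    stable-∪ undominated u v u∈ v∈ u~v with x∈p∪q⁻ S ⁅ q ⁆ u∈ | x∈p∪q⁻ S ⁅ q ⁆ v∈
    ... | inj₁ u∈S | inj₁ v∈S = stable u v u∈S v∈S u~v
    ... | inj₁ u∈S | inj₂ v∈q rewrite x∈⁅y⁆⇒x≡y q v∈q = undominated (u , u∈S , ~-sym u~v)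
    ... | inj₂ u∈q | inj₁ v∈S rewrite x∈⁅y⁆⇒x≡y q u∈q = undominated (v , v∈S , u~v)
    ... | inj₂ u∈q | inj₂ v∈q rewrite x∈⁅y⁆⇒x≡y q u∈q | x∈⁅y⁆⇒x≡y q v∈q = ~-irr q u~v

  module _ (X : Subset n) where

    component-⊆ : ∀ {D D′ v} → Component G X D → Component G X D′ → v ∈ D → v ∈ D′ → D ⊆ D′
    component-⊆ {D} {D′} (D⊆X , _ , connected , _) (_ , _ , _ , closed′) v∈D v∈D′ u∈D =
      walk (connected _ _ v∈D u∈D) v∈D′
      where
      walk : ∀ {x y} → Star (EdgeIn G D) x y → x ∈ D′ → y ∈ D′
      walk ε                          x∈D′ = x∈D′
      walk ((_ , y∈D , x~y) ◅ x⟶y) x∈D′ = walk x⟶y (closed′ _ _ x∈D′ (D⊆X y∈D) x~y)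

    record ConnectedFrom (v : V G) : Set where
      field
        vertices : Subset n
        ⊆X       : vertices ⊆ X
        root     : v ∈ vertices
        reach    : ∀ {u} → u ∈ vertices → Star (EdgeIn G vertices) v u
    open ConnectedFrom

    extend : ∀ {v w u} (A : ConnectedFrom v) → w ∈ vertices A → u ∈ X → w ~ u → u ∉ vertices A →
             Σ (ConnectedFrom v) λ B → ∣ vertices A ∣ < ∣ vertices B ∣
    extend {v} {w} {u} A w∈A u∈X w~u u∉A =
      record { vertices = A′ ; ⊆X = ⊆X′ ; root = old (root A) ; reach = reach′ }
      , p⊂q⇒∣p∣<∣q∣ (old , u , new , u∉A)
      where
      A′ = vertices A ∪ ⁅ u ⁆
      old : vertices A ⊆ A′
      old = p⊆p∪q ⁅ u ⁆
      new : u ∈ A′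
      new = q⊆p∪q (vertices A) ⁅ u ⁆ (x∈⁅x⁆ u)
      ⊆X′ : A′ ⊆ X
      ⊆X′ x∈ with x∈p∪q⁻ (vertices A) ⁅ u ⁆ x∈
      ... | inj₁ x∈A = ⊆X A x∈A
      ... | inj₂ x∈u rewrite x∈⁅y⁆⇒x≡y u x∈u = u∈X
      widen : ∀ {x y} → Star (EdgeIn G (vertices A)) x y → Star (EdgeIn G A′) x y
      widen = gmap id λ { (x∈ , y∈ , x~y) → old x∈ , old y∈ , x~y }
      reach′ : ∀ {x} → x ∈ A′ → Star (EdgeIn G A′) v x
      reach′ x∈ with x∈p∪q⁻ (vertices A) ⁅ u ⁆ x∈
      ... | inj₁ x∈A = widen (reach A x∈A)
      ... | inj₂ x∈u rewrite x∈⁅y⁆⇒x≡y u x∈u = widen (reach A w∈A) ◅◅ ((old w∈A , new , w~u) ◅ ε)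

    closed⇒component : ∀ {v} (A : ConnectedFrom v) →
      (∀ {w u} → w ∈ vertices A → u ∈ X → w ~ u → u ∈ vertices A) → Component G X (vertices A)
    closed⇒component {v} A closed =
      ⊆X A , (v , root A) , (λ u w u∈ w∈ → reverse flip (reach A u∈) ◅◅ reach A w∈)
      , λ _ _ w∈ u∈X w~u → closed w∈ u∈X w~u
      where
      flip : ∀ {x y} → EdgeIn G (vertices A) x y → EdgeIn G (vertices A) y x
      flip (x∈ , y∈ , x~y) = y∈ , x∈ , ~-sym x~y

    grow : ∀ {v} (A : ConnectedFrom v) →
      ∃[ D ] (Component G X D × v ∈ D) ⊎ Σ (ConnectedFrom v) λ B → ∣ vertices A ∣ < ∣ vertices B ∣
    grow A with any? (λ u → (¬? (u ∈? vertices A) ×-dec u ∈? X)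
                           ×-dec any? (λ w → w ∈? vertices A ×-dec ~-dec w u))
    ... | yes (u , (u∉A , u∈X) , w , w∈A , w~u) = inj₂ (extend A w∈A u∈X w~u u∉A)
    ... | no no-exit = inj₁ (vertices A , closed⇒component A closed , root A)
      where
      closed : ∀ {w u} → w ∈ vertices A → u ∈ X → w ~ u → u ∈ vertices A
      closed {w} {u} w∈A u∈X w~u = decidable-stable (u ∈? vertices A) λ u∉A →
        no-exit (u , (u∉A , u∈X) , w , w∈A , w~u)

    component-of : ∀ {v} → v ∈ X → ∃[ D ] (Component G X D × v ∈ D)
    component-of {v} v∈X = ascend (∣_∣ ∘ vertices) (∣p∣≤n ∘ vertices) grow singleton
      where
      singleton : ConnectedFrom v
      singleton = record
        { vertices = ⁅ v ⁆
        ; ⊆X       = λ u∈ → subst (_∈ X) (sym (x∈⁅y⁆⇒x≡y v u∈)) v∈X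
        ; root     = x∈⁅x⁆ v
        ; reach    = λ u∈ → subst (Star _ v) (sym (x∈⁅y⁆⇒x≡y v u∈)) ε
        }

    -- Indexed by the vertex rather than by a proof of v ∈ X, so that properties of
    -- component v are decidable in v; the value ∅ for v ∉ X is never used.
    component : V G → Subset n
    component v with v ∈? X
    ... | yes v∈X = proj₁ (component-of v∈X)
    ... | no _    = ∅

    component-spec : ∀ {v} → v ∈ X → Component G X (component v) × v ∈ component v
    component-spec {v} v∈X with v ∈? X
    ... | yes v∈X′ = proj₂ (component-of v∈X′)
    ... | no v∉X   = contradiction v∈X v∉X

    MeetsEveryComponent : V G → Set
    MeetsEveryComponent z = ∀ D → Component G X D → ∃[ x ] (x ∈ D × z ~ x)

    meets-component-of? : ∀ z v → Dec (v ∈ X → ∃[ x ] (x ∈ component v × z ~ x))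
    meets-component-of? z v = v ∈? X →-dec any? λ x → x ∈? component v ×-dec ~-dec z x

    meets-every-component⊎anticomplete-to-one : ∀ z →
      MeetsEveryComponent z ⊎ ∃[ D ] (Component G X D × AnticompleteTo G z D)
    meets-every-component⊎anticomplete-to-one z with all? (meets-component-of? z)
    ... | yes meets = inj₁ meets-every
      where
      meets-every : MeetsEveryComponent z
      meets-every D D-comp@(D⊆X , (w , w∈D) , _) =
        let x , x∈ , z~x = meets w (D⊆X w∈D)
            w-comp , w∈  = component-spec (D⊆X w∈D)
        in  x , component-⊆ w-comp D-comp w∈ w∈D x∈ , z~x
    ... | no ¬meets with ¬∀⟶∃¬ n _ (meets-component-of? z) ¬meets
    ...   | v , ¬meets-v =
      inj₂ (component v , proj₁ (component-spec v∈X) , λ x x∈ z~x → ¬meets-v λ _ → x , x∈ , z~x)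
      where
      v∈X : v ∈ X
      v∈X = decidable-stable (v ∈? X) λ v∉X → ¬meets-v λ v∈X → contradiction v∈X v∉X

  module _ (p5 : P5Free G) {X Z S : Subset n} (cradle : Cradle G X Z)
           (restricted : Restricted G X Z S) (maximum : MaximumStable G S) where

    MeetsS : Subset n → Set
    MeetsS Q = ∃[ v ] (v ∈ S × v ∈ Q)

    component-meets-S⊎dominated-from-Z : ∀ {Q q} → Component G X Q → q ∈ Q →
      MeetsS Q ⊎ ∃[ s ] (s ∈ S × s ∈ Z × s ~ q)
    component-meets-S⊎dominated-from-Z {Q} {q} (_ , _ , _ , closed) q∈Q with q ∈? S
    ... | yes q∈S = inj₁ (q , q∈S , q∈Q)
    ... | no q∉S with maximum-stable⇒dominating maximum q∉S
    ...   | s , s∈S , q~s with proj₁ restricted s s∈S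
    ...     | inj₁ s∈X = inj₁ (s , s∈S , closed q s q∈Q s∈X q~s)
    ...     | inj₂ s∈Z = inj₂ (s , s∈S , s∈Z , ~-sym q~s)

    N-in-X : V G → Subset n
    N-in-X s = select λ v → v ∈? X ×-dec ~-dec s v

    N-in-X-grows : ∀ {s s′ Q q} → s ∈ S → s ∈ Z → s′ ∈ S → s′ ∈ Z → Component G X Q →
      AnticompleteTo G s Q → q ∈ Q → s′ ~ q → N-in-X s ⊂ N-in-X s′
    N-in-X-grows {s} {s′} {Q} {q} s∈S s∈Z s′∈S s′∈Z (Q⊆X , _ , _ , closed) s≁Q q∈Q s′~q =
      inherited , q , ∈-select⁺ _ (Q⊆X q∈Q , s′~q) , λ q∈N → s≁Q q q∈Q (proj₂ (∈-select⁻ _ q∈N))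
      where
      inherited : N-in-X s ⊆ N-in-X s′
      inherited {a} a∈N with ∈-select⁻ _ a∈N
      ... | a∈X , s~a = ∈-select⁺ _ (a∈X , cradle-shared-neighbour p5 cradle a∈X (Q⊆X q∈Q) s∈Z s′∈Z
                          (proj₁ maximum s s′ s∈S s′∈S) s~a s′~q (s≁Q q q∈Q) a≁q)
        where
        a≁q : ¬ a ~ q
        a≁q a~q = s≁Q a (closed q a q∈Q a∈X (~-sym a~q)) s~a

    module _ {𝓘 𝓙 : Collection G}
             (𝓘-components : ∀ D → 𝓘 D → Component G X D) (𝓘-covers : Covers G X Z 𝓘)
             (𝓙-complete : ∀ D → Component G X D →
                ∃[ z ] (z ∈ Z × MeetsEveryComponent X z × ∃[ x ] (x ∈ D × ¬ z ~ x)) → 𝓙 D) where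

      RockerMeetsS : Set
      RockerMeetsS = ∃[ Q ] ((𝓘 Q ⊎ 𝓙 Q) × MeetsS Q)

      meets-every-component⇒𝓙-meets-S : ∀ {s} → s ∈ S → s ∈ Z → MeetsEveryComponent X s → RockerMeetsS
      meets-every-component⇒𝓙-meets-S {s} s∈S s∈Z meets with proj₂ restricted
      ... | x , x∈S , x∈X with component-of X x∈X
      ...   | D , D-comp , x∈D =
        D , inj₂ (𝓙-complete D D-comp (s , s∈Z , meets , x , x∈D , proj₁ maximum s x s∈S x∈S)) , x , x∈S , x∈D

      S∩Z : Set
      S∩Z = Σ (V G) λ s → s ∈ S × s ∈ Z

      advance : (t : S∩Z) → RockerMeetsS ⊎ Σ S∩Z λ t′ → ∣ N-in-X (proj₁ t) ∣ < ∣ N-in-X (proj₁ t′) ∣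
      advance (s , s∈S , s∈Z) with meets-every-component⊎anticomplete-to-one X s
      ... | inj₁ meets = inj₁ (meets-every-component⇒𝓙-meets-S s∈S s∈Z meets)
      ... | inj₂ D-anti with 𝓘-covers s s∈Z D-anti
      ...   | Q , Q∈𝓘 , s≁Q with 𝓘-components Q Q∈𝓘
      ...     | Q-comp@(_ , (q , q∈Q) , _) with component-meets-S⊎dominated-from-Z Q-comp q∈Q
      ...       | inj₁ S-meets-Q = inj₁ (Q , inj₁ Q∈𝓘 , S-meets-Q)
      ...       | inj₂ (s′ , s′∈S , s′∈Z , s′~q) =
        inj₂ ((s′ , s′∈S , s′∈Z) , p⊂q⇒∣p∣<∣q∣ (N-in-X-grows s∈S s∈Z s′∈S s′∈Z Q-comp s≁Q q∈Q s′~q))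

      rocker-component : ∀ {z} → z ∈ Z → ¬ CompleteTo G z X → ∃[ Q ] (Component G X Q × (𝓘 Q ⊎ 𝓙 Q))
      rocker-component {z} z∈Z z≁X with meets-every-component⊎anticomplete-to-one X z
      ... | inj₂ D-anti with 𝓘-covers z z∈Z D-anti
      ...   | Q , Q∈𝓘 , _ = Q , 𝓘-components Q Q∈𝓘 , inj₁ Q∈𝓘
      rocker-component {z} z∈Z z≁X | inj₁ meets with ¬complete⇒non-neighbour z≁X
      ... | x , x∈X , z≁x with component-of X x∈X
      ...   | D , D-comp , x∈D = D , D-comp , inj₂ (𝓙-complete D D-comp (z , z∈Z , meets , x , x∈D , z≁x))

      rocker-meets-S : ∀ {z} → z ∈ Z → ¬ CompleteTo G z X → RockerMeetsS
      rocker-meets-S z∈Z z≁X with rocker-component z∈Z z≁X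
      ... | Q , Q-comp@(_ , (q , q∈Q) , _) , Q∈𝓘∪𝓙 with component-meets-S⊎dominated-from-Z Q-comp q∈Q
      ...   | inj₁ S-meets-Q          = Q , Q∈𝓘∪𝓙 , S-meets-Q
      ...   | inj₂ (s , s∈S , s∈Z , _) =
        ascend (∣_∣ ∘ N-in-X ∘ proj₁) (∣p∣≤n ∘ N-in-X ∘ proj₁) advance (s , s∈S , s∈Z)

lemma3p3 : (G : Graph) → P5Free G →
    (X Z : Subset (Graph.n G)) → Cradle G X Z →
    (∃[ z ] (z ∈ Z × ¬ CompleteTo G z X)) →
    (𝓘 𝓙 : Collection G) → Rocker G X Z 𝓘 𝓙 →
    (S : Subset (Graph.n G)) → Restricted G X Z S → MaximumStable G S →
    ∃[ Q ] ((𝓘 Q ⊎ 𝓙 Q) × ∃[ v ] (v ∈ S × v ∈ Q))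
lemma3p3 G p5 X Z cradle (z , z∈Z , z≁X) 𝓘 𝓙 (𝓘-components , 𝓘-covers , _ , _ , 𝓙-complete) S restricted maximum =
  rocker-meets-S G p5 cradle restricted maximum 𝓘-components 𝓘-covers 𝓙-complete z∈Z z≁X
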